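{- Let $M=(\Sigma_\Box,Q,q_{in},q_{fin},\delta)$ be a Turing machine. There is a term $\mathtt{trans}$ of $\Lambda_{\tt det}$ such that for every continuation $k$ (a value) and every configuration $C$ of $M$: (1) if $D$ is a final configuration reachable from $C$ in $n$ transition steps, then $\mathtt{trans}\; k\; \ulcorner C\urcorner \rightarrow_{det}^{O(n)} k\; \ulcorner D\urcorner$; (2) if no final configuration is reachable from $C$, then $\mathtt{trans}\; k\; \ulcorner C\urcorner$ diverges (has an infinite $\rightarrow_{det}$-reduction sequence).
   Context: $\Lambda_{\tt det}$: terms $t ::= v \mid t\,v$, values $v ::= \lambda x.t \mid x$; evaluation contexts $E ::= [\cdot] \mid E\,v$; reduction $E[(\lambda x.t)s] \rightarrow_{det} E[t\{x:=s\}]$; $\rightarrow_{det}^{O(n)}$ is a reduction of at most $c\cdot n + c$ steps for a constant $c$ depending only on $M$. A Turing machine $M$ has a finite alphabet $\Sigma=\{a_1,\dots,a_n\}$ plus a blank $\Box$ (tape alphabet $\Sigma_\Box$, $\Box$ last), a finite state set $Q$, initial/final states $q_{in},q_{fin}$, and a partial transition function $\delta$ from $Q\times\Sigma_\Box$ to $Q\times\Sigma_\Box\times\{\leftarrow,\rightarrow,\downarrow\}$ defined exactly on pairs whose state is not $q_{fin}$. A configuration $(s,a,r,q)$ consists of the tape left of the head, the symbol under the head, the tape right of the head, and the state; it is final if $q=q_{fin}$. Transitions for $C=(s,a_j,r,q_i)$ with $\delta(q_i,a_j)=(q_l,a_h,d)$: $d={\downarrow}$ gives $(s,a_h,r,q_l)$;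 $d={\leftarrow}$ gives $(p,a_p,a_h r,q_l)$ if $s=pa_p$ and $(\varepsilon,\Box,a_hr,q_l)$ if $s=\varepsilon$; $d={\rightarrow}$ gives $(sa_h,a_p,p,q_l)$ if $r=a_pp$ and $(sa_h,\Box,\varepsilon,q_l)$ if $r=\varepsilon$. Scott encoding for an ordered alphabet $\Delta=\{b_1,\dots,b_n\}$: $\ulcorner b_i\urcorner_\Delta := \lambda x_1.\dots\lambda x_n.x_i$, $\ulcorner \varepsilon\urcorner_{\Delta^*} := \lambda x_1.\dots\lambda x_n.\lambda y.y$, $\ulcorner b_i r\urcorner_{\Delta^*} := \lambda x_1.\dots\lambda x_n.\lambda y.x_i\,\ulcorner r\urcorner_{\Delta^*}$; $Q$ is encoded as an alphabet. Configurations: $\ulcorner (s,a,r,q)\urcorner := \lambda x.\, x\,\ulcorner s^r\urcorner_{\Sigma_\Box^*}\,\ulcorner a\urcorner_{\Sigma_\Box}\,\ulcorner r\urcorner_{\Sigma_\Box^*}\,\ulcorner q\urcorner_Q$, with $s^r$ the reversal of $s$. -}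

module Defs where

open import Data.Nat using (ℕ; zero; suc; _∸_; _<ᵇ_; _≡ᵇ_; _+_; _*_; _≤_)
open import Data.Bool using (if_then_else_)
open import Data.Fin using (Fin; toℕ; fromℕ)
open import Data.List using (List; []; _∷_; _++_; reverse; [_])
open import Data.Product using (_×_; _,_; Σ)
open import Relation.Binary.PropositionalEquality using (_≡_; _≢_)

-- The calculus Λ_det, with de Bruijn indices (variables are ℕ, terms
-- may be open).
--   terms  t ::= v | t v        values v ::= λ.t | x

mutual
  data Term : Set where
    val : Val → Term
    app : Term → Val → Term

  data Val : Set where
    var : ℕ → Val
    lam : Term → Val

mutual
  shiftT : ℕ → Term → Term
  shiftT c (val v)   = val (shiftV c v)
  shiftT c (app t v) = app (shiftT c t) (shiftV c v)

  shiftV : ℕ → Val → Val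
  shiftV c (var i) = if i <ᵇ c then var i else var (suc i)
  shiftV c (lam t) = lam (shiftT (suc c) t)

-- capture-avoiding substitution of the value s for variable j
-- (free variables above j are decremented, as the binder disappears)
mutual
  substT : ℕ → Val → Term → Term
  substT j s (val v)   = val (substV j s v)
  substT j s (app t v) = app (substT j s t) (substV j s v)

  substV : ℕ → Val → Val → Val
  substV j s (var i) =
    if i ≡ᵇ j then s else (if i <ᵇ j then var i else var (i ∸ 1))
  substV j s (lam t) = lam (substT (suc j) (shiftV 0 s) t)

_[_≔] : Term → Val → Term
t [ s ≔] = substT 0 s t

data _⟶_ : Term → Term → Set where
  β   : ∀ {t s} → app (val (lam t)) s ⟶ (t [ s ≔])
  ctx : ∀ {t t′ v} → t ⟶ t′ → app t v ⟶ app t′ v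

data Reds : ℕ → Term → Term → Set where
  refl⟶ : ∀ {t} → Reds 0 t t
  step⟶ : ∀ {m t u w} → t ⟶ u → Reds m u w → Reds (suc m) t w

Diverges : Term → Set
Diverges t = Σ (ℕ → Term) λ f → (f 0 ≡ t) × (∀ i → f i ⟶ f (suc i))

-- Turing machines.  Σ = Fin n, Σ_□ = Fin (suc n) with □ the last
-- element, Q = Fin m.

data Dir : Set where
  L R S : Dir

record TM : Set where
  field
    n    : ℕ
    m    : ℕ
    qin  : Fin m
    qfin : Fin m
    δ    : (q : Fin m) → q ≢ qfin → Fin (suc n) → Fin m × Fin (suc n) × Dir

module _ (M : TM) where
  open TM M

  Sym : Set
  Sym = Fin (suc n)

  □ : Sym
  □ = fromℕ n

  -- (s , a , r , q): left tape (left to right), head symbol, right tape, state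
  record Config : Set where
    constructor ⟨_,_,_,_⟩
    field
      left  : List Sym
      head  : Sym
      right : List Sym
      state : Fin m
  open Config public

  Final : Config → Set
  Final C = state C ≡ qfin

  private
    moveL : List Sym → Sym → List Sym → Fin m → List Sym → Config
    moveL s ah r ql []        = ⟨ [] , □ , ah ∷ r , ql ⟩
    moveL s ah r ql (ap ∷ rp) = ⟨ reverse rp , ap , ah ∷ r , ql ⟩   -- s = p a_p with p = reverse rp

    moveR : List Sym → Sym → List Sym → Fin m → Config
    moveR s ah []       ql = ⟨ s ++ [ ah ] , □ , [] , ql ⟩
    moveR s ah (ap ∷ p) ql = ⟨ s ++ [ ah ] , ap , p , ql ⟩

    apply : List Sym → List Sym → Fin m × Sym × Dir → Config
    apply s r (ql , ah , S) = ⟨ s , ah , r , ql ⟩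
    apply s r (ql , ah , L) = moveL s ah r ql (reverse s)
    apply s r (ql , ah , R) = moveR s ah r ql

  next : (C : Config) → state C ≢ qfin → Config
  next ⟨ s , a , r , q ⟩ ne = apply s r (δ q ne a)

  data Steps : ℕ → Config → Config → Set where
    done : ∀ {C} → Steps 0 C C
    step : ∀ {k C D} (ne : state C ≢ qfin) → Steps k (next C ne) D → Steps (suc k) C D

lams : ℕ → Term → Term
lams zero    t = t
lams (suc k) t = val (lam (lams k t))

-- ⌜b_i⌝ = λx_1…λx_N. x_i   (i is 0-based here)
encLetter : ∀ {N} → Fin N → Val
encLetter {suc N} i = lam (lams N (val (var (N ∸ toℕ i))))

-- ⌜ε⌝ = λx_1…λx_N.λy.y ,  ⌜b_i r⌝ = λx_1…λx_N.λy. x_i ⌜r⌝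
encStr : ∀ {N} → List (Fin N) → Val
encStr {N} []      = lam (lams N (val (var 0)))
encStr {N} (b ∷ r) = lam (lams N (app (val (var (N ∸ toℕ b))) (encStr r)))

-- ⌜(s,a,r,q)⌝ = λx. x ⌜s^r⌝ ⌜a⌝ ⌜r⌝ ⌜q⌝
encConfig : (M : TM) → Config M → Val
encConfig M ⟨ s , a , r , q ⟩ =
  lam (app (app (app (app (val (var 0)) (encStr (reverse s))) (encLetter a)) (encStr r)) (encLetter q))

-- trans = loop loop, where loop y k c = c unpack y k feeds the encoded configuration to
-- unpack.  Dispatching on the Scott-encoded state and head symbol selects a combinator for
-- δ(q, a), which rebuilds the encoding of the next configuration (one further dispatch on a
-- tape string for a move) and calls y y k on it, or hands ⌜C⌝ to k when q = q_fin.  Each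
-- dispatch over an alphabet costs as many β-steps as the alphabet has letters, so a
-- transition costs a constant depending only on M, and since it costs at least one step, a
-- run that never halts yields an infinite reduction.
module Submission where

open import Defs
open import Data.Bool using (Bool; true; false; T; _∧_; if_then_else_)
open import Data.Bool.Properties using (T-≡; T-∧)
open import Data.Fin using (Fin; toℕ; fromℕ; inject₁; _≟_) renaming (zero to fzero; suc to fsuc)
open import Data.Fin.Properties using (toℕ-fromℕ; toℕ-inject₁)
open import Data.List using (List; []; _∷_; [_]; length; map; reverse; tabulate)
open import Data.List.Properties using (reverse-involutive; reverse-++)
open import Data.Nat using (ℕ; zero; suc; _+_; _*_; _∸_; _<ᵇ_; _≡ᵇ_; _≤_; _<_; z≤n; s≤s)
open import Data.Nat.Properties hiding (_≟_)
open import Data.Product using (Σ; ∃; _×_; _,_; proj₁; proj₂)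
open import Data.Unit using (tt)
open import Function using (_∘_)
open import Function.Bundles using (Equivalence)
open import Relation.Binary.PropositionalEquality hiding ([_]; trans)
open import Relation.Nullary using (¬_; Dec; yes; no; contradiction)

<⇒<ᵇ≡true : ∀ {i j} → i < j → (i <ᵇ j) ≡ true
<⇒<ᵇ≡true i<j = Equivalence.to T-≡ (<⇒<ᵇ i<j)

≮⇒<ᵇ≡false : ∀ {i j} → ¬ i < j → (i <ᵇ j) ≡ false
≮⇒<ᵇ≡false {i} {j} i≮j with i <ᵇ j in e
... | false = refl
... | true  = contradiction (<ᵇ⇒< i j (Equivalence.from T-≡ e)) i≮j

≢⇒≡ᵇ≡false : ∀ {i j} → i ≢ j → (i ≡ᵇ j) ≡ false
≢⇒≡ᵇ≡false {i} {j} i≢j with i ≡ᵇ j in e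
... | false = refl
... | true  = contradiction (≡ᵇ⇒≡ i j (Equivalence.from T-≡ e)) i≢j

substV-var-< : ∀ {i j s} → i < j → substV j s (var i) ≡ var i
substV-var-< i<j rewrite ≢⇒≡ᵇ≡false (<⇒≢ i<j) | <⇒<ᵇ≡true i<j = refl

substV-var-≡ : ∀ {j s} → substV j s (var j) ≡ s
substV-var-≡ {j} rewrite Equivalence.to T-≡ (≡⇒≡ᵇ j j refl) = refl

substV-var-> : ∀ {i j s} → j < i → substV j s (var i) ≡ var (i ∸ 1)
substV-var-> j<i rewrite ≢⇒≡ᵇ≡false (>⇒≢ j<i) | ≮⇒<ᵇ≡false (<⇒≯ j<i) = refl

mutual
  ClosedT : ℕ → Term → Set
  ClosedT d (val v)   = ClosedV d v
  ClosedT d (app t v) = ClosedT d t × ClosedV d v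

  ClosedV : ℕ → Val → Set
  ClosedV d (var i) = i < d
  ClosedV d (lam t) = ClosedT (suc d) t

Closed : Val → Set
Closed = ClosedV 0

mutual
  closedT-weaken : ∀ {d e} t → d ≤ e → ClosedT d t → ClosedT e t
  closedT-weaken (val v)   d≤e cv        = closedV-weaken v d≤e cv
  closedT-weaken (app t v) d≤e (ct , cv) = closedT-weaken t d≤e ct , closedV-weaken v d≤e cv

  closedV-weaken : ∀ {d e} v → d ≤ e → ClosedV d v → ClosedV e v
  closedV-weaken (var i) d≤e i<d = ≤-trans i<d d≤e
  closedV-weaken (lam t) d≤e ct  = closedT-weaken t (s≤s d≤e) ct

mutual
  shiftT-closed : ∀ {d} c t → ClosedT d t → d ≤ c → shiftT c t ≡ t
  shiftT-closed c (val v)   cv        d≤c = cong val (shiftV-closed c v cv d≤c)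
  shiftT-closed c (app t v) (ct , cv) d≤c = cong₂ app (shiftT-closed c t ct d≤c) (shiftV-closed c v cv d≤c)

  shiftV-closed : ∀ {d} c v → ClosedV d v → d ≤ c → shiftV c v ≡ v
  shiftV-closed c (var i) i<d d≤c rewrite <⇒<ᵇ≡true (≤-trans i<d d≤c) = refl
  shiftV-closed c (lam t) ct  d≤c = cong lam (shiftT-closed (suc c) t ct (s≤s d≤c))

mutual
  substT-closed : ∀ {d} j s t → ClosedT d t → d ≤ j → substT j s t ≡ t
  substT-closed j s (val v)   cv        d≤j = cong val (substV-closed j s v cv d≤j)
  substT-closed j s (app t v) (ct , cv) d≤j = cong₂ app (substT-closed j s t ct d≤j) (substV-closed j s v cv d≤j)

  substV-closed : ∀ {d} j s v → ClosedV d v → d ≤ j → substV j s v ≡ v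
  substV-closed j s (var i) i<d d≤j = substV-var-< (≤-trans i<d d≤j)
  substV-closed j s (lam t) ct  d≤j = cong lam (substT-closed (suc j) (shiftV 0 s) t ct (s≤s d≤j))

shift-closed : ∀ {s} c → Closed s → shiftV c s ≡ s
shift-closed {s} c cs = shiftV-closed c s cs z≤n

subst-closed : ∀ {v} j s → Closed v → substV j s v ≡ v
subst-closed {v} j s cv = substV-closed j s v cv z≤n

mutual
  substT-shiftT : ∀ j s t → substT j s (shiftT j t) ≡ t
  substT-shiftT j s (val v)   = cong val (substV-shiftV j s v)
  substT-shiftT j s (app t v) = cong₂ app (substT-shiftT j s t) (substV-shiftV j s v)

  substV-shiftV : ∀ j s v → substV j s (shiftV j v) ≡ v
  substV-shiftV j s (var i) with i <ᵇ j in e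
  ... | true  = substV-var-< (<ᵇ⇒< i j (Equivalence.from T-≡ e))
  ... | false = substV-var-> {j = j} {s} (s≤s (≮⇒≥ λ i<j → subst T e (<⇒<ᵇ i<j)))
  substV-shiftV j s (lam t) = cong lam (substT-shiftT (suc j) (shiftV 0 s) t)

substT-lams : ∀ k j s → Closed s → ∀ t → substT j s (lams k t) ≡ lams k (substT (k + j) s t)
substT-lams zero    j s cs t = refl
substT-lams (suc k) j s cs t
  rewrite shift-closed {s} 0 cs | substT-lams k (suc j) s cs t | +-suc k j = refl

closedT-lams : ∀ k {d} t → ClosedT (k + d) t → ClosedT d (lams k t)
closedT-lams zero    t ct = ct
closedT-lams (suc k) {d} t ct = closedT-lams k t (subst (λ e → ClosedT e t) (sym (+-suc k d)) ct)

ClosedVal : Set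
ClosedVal = Σ Val Closed

infixr 5 _◅◅_
infixl 6 _·_
infix  7 #_ ‹_›

-- Templates: terms whose holes ‹ c › carry closed values, so instantiating
-- their bound variables never needs to shift anything.
mutual
  data Tmpl : Set where
    ⌊_⌋ : TmplV → Tmpl
    _·_ : Tmpl → TmplV → Tmpl

  data TmplV : Set where
    ‹_› : ClosedVal → TmplV
    #_  : ℕ → TmplV
    ƛ_  : Tmpl → TmplV

mutual
  ⟦_⟧ : Tmpl → Term
  ⟦ ⌊ v ⌋ ⟧ = val ⟦ v ⟧ᵛ
  ⟦ t · v ⟧ = app ⟦ t ⟧ ⟦ v ⟧ᵛ

  ⟦_⟧ᵛ : TmplV → Val
  ⟦ ‹ c › ⟧ᵛ = proj₁ c
  ⟦ # i ⟧ᵛ   = var i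
  ⟦ ƛ t ⟧ᵛ   = lam ⟦ t ⟧

mutual
  inst : ℕ → ClosedVal → Tmpl → Tmpl
  inst j s ⌊ v ⌋   = ⌊ instᵛ j s v ⌋
  inst j s (t · v) = inst j s t · instᵛ j s v

  instᵛ : ℕ → ClosedVal → TmplV → TmplV
  instᵛ j s ‹ c › = ‹ c ›
  instᵛ j s (# i) = if i ≡ᵇ j then ‹ s › else (if i <ᵇ j then # i else # (i ∸ 1))
  instᵛ j s (ƛ t) = ƛ inst (suc j) s t

mutual
  substT-⟦⟧ : ∀ j s t → substT j (proj₁ s) ⟦ t ⟧ ≡ ⟦ inst j s t ⟧
  substT-⟦⟧ j s ⌊ v ⌋   = cong val (substV-⟦⟧ j s v)
  substT-⟦⟧ j s (t · v) = cong₂ app (substT-⟦⟧ j s t) (substV-⟦⟧ j s v)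

  substV-⟦⟧ : ∀ j s v → substV j (proj₁ s) ⟦ v ⟧ᵛ ≡ ⟦ instᵛ j s v ⟧ᵛ
  substV-⟦⟧ j s ‹ _ , cc › = subst-closed j (proj₁ s) cc
  substV-⟦⟧ j s (# i) with i ≡ᵇ j | i <ᵇ j
  ... | true  | _     = refl
  ... | false | true  = refl
  ... | false | false = refl
  substV-⟦⟧ j (s , cs) (ƛ t) rewrite shift-closed {s} 0 cs = cong lam (substT-⟦⟧ (suc j) (s , cs) t)

tlams : ℕ → Tmpl → Tmpl
tlams zero    t = t
tlams (suc k) t = ⌊ ƛ tlams k t ⌋

inst-tlams : ∀ k j s t → inst j s (tlams k t) ≡ tlams k (inst (k + j) s t)
inst-tlams zero    j s t = refl
inst-tlams (suc k) j s t rewrite inst-tlams k (suc j) s t | +-suc k j = refl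

-- Closedness of a template is decidable, so concrete combinators are closed by tt.
mutual
  closedᵇ : ℕ → Tmpl → Bool
  closedᵇ d ⌊ v ⌋   = closedᵇᵛ d v
  closedᵇ d (t · v) = closedᵇ d t ∧ closedᵇᵛ d v

  closedᵇᵛ : ℕ → TmplV → Bool
  closedᵇᵛ d ‹ _ › = true
  closedᵇᵛ d (# i) = i <ᵇ d
  closedᵇᵛ d (ƛ t) = closedᵇ (suc d) t

mutual
  closedᵇ-sound : ∀ d t → T (closedᵇ d t) → ClosedT d ⟦ t ⟧
  closedᵇ-sound d ⌊ v ⌋   p = closedᵇᵛ-sound d v p
  closedᵇ-sound d (t · v) p with Equivalence.to T-∧ p
  ... | pt , pv = closedᵇ-sound d t pt , closedᵇᵛ-sound d v pv

  closedᵇᵛ-sound : ∀ d v → T (closedᵇᵛ d v) → ClosedV d ⟦ v ⟧ᵛ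
  closedᵇᵛ-sound d ‹ c , cc › p = closedV-weaken c z≤n cc
  closedᵇᵛ-sound d (# i) p      = <ᵇ⇒< i d p
  closedᵇᵛ-sound d (ƛ t) p      = closedᵇ-sound (suc d) t p

combinator : ∀ k (body : Tmpl) → T (closedᵇ 1 (tlams k body)) → ClosedVal
combinator k body p = ⟦ ƛ tlams k body ⟧ᵛ , closedᵇ-sound 1 (tlams k body) p

apps : Term → List Val → Term
apps t []       = t
apps t (v ∷ vs) = apps (app t v) vs

⟶-apps : ∀ {t u} vs → t ⟶ u → apps t vs ⟶ apps u vs
⟶-apps []       r = r
⟶-apps (v ∷ vs) r = ⟶-apps vs (ctx r)

Reds-apps : ∀ {k t u} vs → Reds k t u → Reds k (apps t vs) (apps u vs)
Reds-apps vs refl⟶        = refl⟶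
Reds-apps vs (step⟶ r rs) = step⟶ (⟶-apps vs r) (Reds-apps vs rs)

_◅◅_ : ∀ {a b t u w} → Reds a t u → Reds b u w → Reds (a + b) t w
refl⟶      ◅◅ rs′ = rs′
step⟶ r rs ◅◅ rs′ = step⟶ r (rs ◅◅ rs′)

β≡ : ∀ {t s u} → u ≡ t [ s ≔] → app (val (lam t)) s ⟶ u
β≡ refl = β

instAll : Tmpl → List ClosedVal → Tmpl
instAll t []       = t
instAll t (c ∷ cs) = instAll (inst (length cs) c t) cs

tlams-β* : ∀ t (cs : List ClosedVal) →
  Reds (length cs) (apps ⟦ tlams (length cs) t ⟧ (map proj₁ cs)) ⟦ instAll t cs ⟧
tlams-β* t []       = refl⟶
tlams-β* t (c ∷ cs) = step⟶ (⟶-apps (map proj₁ cs) (β≡ contract)) (tlams-β* (inst k c t) cs)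
  where
  k = length cs
  contract : ⟦ tlams k (inst k c t) ⟧ ≡ ⟦ tlams k t ⟧ [ proj₁ c ≔]
  contract rewrite substT-⟦⟧ 0 c (tlams k t) | inst-tlams k 0 c t | +-identityʳ k = refl

closedT-apps : ∀ {d t} cs → ClosedT d t → ClosedT d (apps t (map proj₁ cs))
closedT-apps []              ct = ct
closedT-apps ((v , cv) ∷ cs) ct = closedT-apps cs (ct , closedV-weaken v z≤n cv)

substT-apps : ∀ j s t cs → substT j s (apps t (map proj₁ cs)) ≡ apps (substT j s t) (map proj₁ cs)
substT-apps j s t []              = refl
substT-apps j s t ((v , cv) ∷ cs) = begin
  substT j s (apps (app t v) (map proj₁ cs))      ≡⟨ substT-apps j s (app t v) cs ⟩
  apps (app (substT j s t) (substV j s v)) (map proj₁ cs) ≡⟨ cong (λ w → apps (app (substT j s t) w) (map proj₁ cs)) (subst-closed j s cv) ⟩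
  apps (app (substT j s t) v) (map proj₁ cs)      ∎
  where open ≡-Reasoning

-- dispatch cs = λx. x c₁ … cₙ: applied to a Scott-encoded letter it selects a branch.
dispatch : List ClosedVal → ClosedVal
dispatch cs = lam (apps (val (var 0)) (map proj₁ cs)) , closedT-apps cs (s≤s z≤n)

dispatch-β : ∀ cs q → Reds 1 (app (val (proj₁ (dispatch cs))) q) (apps (val q) (map proj₁ cs))
dispatch-β cs q = step⟶ (β≡ (sym (substT-apps 0 q (val (var 0)) cs))) refl⟶

-- Instances: bodies of Scott-encoded letters (plug = val) and strings (plug u = u ⌜r⌝).
record Plug : Set where
  field
    plug        : Val → Term
    substT-plug : ∀ j s u → Closed s → substT j s (plug u) ≡ plug (substV j s u)
open Plug

valPlug : Plug
valPlug = record { plug = val ; substT-plug = λ _ _ _ _ → refl }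

lams-β-discard : ∀ k (B : Fin k → ClosedVal) t → (∀ j s → Closed s → substT j s t ≡ t) →
  Reds k (apps (lams k t) (map proj₁ (tabulate B))) t
lams-β-discard zero    B t t-closed = refl⟶
lams-β-discard (suc k) B t t-closed =
  step⟶ (⟶-apps (map proj₁ (tabulate (B ∘ fsuc))) (β≡ contract)) (lams-β-discard k (B ∘ fsuc) t t-closed)
  where
  contract : lams k t ≡ lams k t [ proj₁ (B fzero) ≔]
  contract rewrite substT-lams k 0 (proj₁ (B fzero)) (proj₂ (B fzero)) t
                 | t-closed (k + 0) (proj₁ (B fzero)) (proj₂ (B fzero)) = refl

lams-β-select : ∀ k (P : Plug) (B : Fin k → ClosedVal) (i : Fin k) x → x ≡ k ∸ suc (toℕ i) →
  Reds k (apps (lams k (plug P (var x))) (map proj₁ (tabulate B))) (plug P (proj₁ (B i)))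
lams-β-select (suc k) P B fzero x refl =
  step⟶ (⟶-apps (map proj₁ (tabulate (B ∘ fsuc))) (β≡ contract)) (lams-β-discard k (B ∘ fsuc) _ plug-closed)
  where
  c = proj₁ (B fzero)
  cc = proj₂ (B fzero)
  contract : lams k (plug P c) ≡ lams k (plug P (var k)) [ c ≔]
  contract rewrite substT-lams k 0 c cc (plug P (var k)) | +-identityʳ k
                 | substT-plug P k c (var k) cc | substV-var-≡ {k} {c} = refl
  plug-closed : ∀ j s → Closed s → substT j s (plug P c) ≡ plug P c
  plug-closed j s cs rewrite substT-plug P j s c cs | subst-closed {c} j s cc = refl
lams-β-select (suc (suc k)) P B (fsuc i) x x≡ =
  step⟶ (⟶-apps (map proj₁ (tabulate (B ∘ fsuc))) (β≡ contract)) (lams-β-select (suc k) P (B ∘ fsuc) i x x≡)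
  where
  c = proj₁ (B fzero)
  cc = proj₂ (B fzero)
  x<k : x < suc k
  x<k rewrite x≡ = s≤s (m∸n≤m k (toℕ i))
  contract : lams (suc k) (plug P (var x)) ≡ lams (suc k) (plug P (var x)) [ c ≔]
  contract rewrite substT-lams (suc k) 0 c cc (plug P (var x)) | +-identityʳ k
                 | substT-plug P (suc k) c (var x) cc | substV-var-< {x} {suc k} {c} x<k = refl

infix  2 _⇒⟨_⟩_ _⇒⁺⟨_⟩_
infixr 4 _⨾_

_⇒⟨_⟩_ : Term → ℕ → Term → Set
t ⇒⟨ b ⟩ u = ∃ λ j → j ≤ b × Reds j t u

_⇒⁺⟨_⟩_ : Term → ℕ → Term → Set
t ⇒⁺⟨ b ⟩ u = ∃ λ j → suc j ≤ b × Reds (suc j) t u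

exactly : ∀ {j t u} → Reds j t u → t ⇒⟨ j ⟩ u
exactly rs = _ , ≤-refl , rs

_⨾_ : ∀ {a b t u w} → t ⇒⟨ a ⟩ u → u ⇒⟨ b ⟩ w → t ⇒⟨ a + b ⟩ w
(j , j≤a , rs) ⨾ (j′ , j′≤b , rs′) = j + j′ , +-mono-≤ j≤a j′≤b , rs ◅◅ rs′

relax : ∀ {a b t u} → a ≤ b → t ⇒⟨ a ⟩ u → t ⇒⟨ b ⟩ u
relax a≤b (j , j≤a , rs) = j , ≤-trans j≤a a≤b , rs

∸<+suc : ∀ N x k → N ∸ x < N + suc k
∸<+suc N x k rewrite +-suc N k = s≤s (≤-trans (m∸n≤m N x) (m≤m+n N k))

encLetter-closed : ∀ {k} (i : Fin k) → Closed (encLetter i)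
encLetter-closed {suc k} i = closedT-lams k _ (∸<+suc k (toℕ i) 0)

encStr-closed : ∀ {N} (r : List (Fin N)) → Closed (encStr r)
encStr-closed {N} []      = closedT-lams N _ (m≤n+m 1 N)
encStr-closed {N} (b ∷ r) = closedT-lams N _ (∸<+suc N (toℕ b) 0 , closedV-weaken (encStr r) z≤n (encStr-closed r))

letterᶜ : ∀ {k} → Fin k → ClosedVal
letterᶜ i = encLetter i , encLetter-closed i

stringᶜ : ∀ {N} → List (Fin N) → ClosedVal
stringᶜ r = encStr r , encStr-closed r

encLetter-select : ∀ {k} (i : Fin k) (B : Fin k → ClosedVal) →
  Reds k (apps (val (encLetter i)) (map proj₁ (tabulate B))) (val (proj₁ (B i)))
encLetter-select {suc k} i B = lams-β-select (suc k) valPlug B i (k ∸ toℕ i) refl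

snoc : ∀ {a} {A : Set a} {k} → (Fin k → A) → A → Fin (suc k) → A
snoc {k = zero}  B w _        = w
snoc {k = suc k} B w fzero    = B fzero
snoc {k = suc k} B w (fsuc i) = snoc (B ∘ fsuc) w i

snoc-last : ∀ {a} {A : Set a} k (B : Fin k → A) w → snoc B w (fromℕ k) ≡ w
snoc-last zero    B w = refl
snoc-last (suc k) B w = snoc-last k (B ∘ fsuc) w

snoc-inject₁ : ∀ {a} {A : Set a} {k} (B : Fin k → A) w i → snoc B w (inject₁ i) ≡ B i
snoc-inject₁ {k = suc k} B w fzero    = refl
snoc-inject₁ {k = suc k} B w (fsuc i) = snoc-inject₁ (B ∘ fsuc) w i

-- A string over N letters is eliminated by N cons-branches followed by the ε-branch.
module _ (N : ℕ) (B : Fin N → ClosedVal) (w : ClosedVal) where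

  private
    branches : List Val
    branches = map proj₁ (tabulate (snoc B w))

  encStr-[]-select : Reds (suc N) (apps (val (encStr {N} [])) branches) (val (proj₁ w))
  encStr-[]-select =
    subst (Reds (suc N) (apps (val (encStr {N} [])) branches) ∘ val ∘ proj₁) (snoc-last N B w)
      (lams-β-select (suc N) valPlug (snoc B w) (fromℕ N) 0 0≡)
    where
    0≡ : 0 ≡ N ∸ toℕ (fromℕ N)
    0≡ rewrite toℕ-fromℕ N = sym (n∸n≡0 N)

  encStr-∷-select : ∀ b r → Reds (suc N) (apps (val (encStr (b ∷ r))) branches) (app (val (proj₁ (B b))) (encStr r))
  encStr-∷-select b r =
    subst (λ c → Reds (suc N) (apps (val (encStr (b ∷ r))) branches) (app (val (proj₁ c)) (encStr r))) (snoc-inject₁ B w b)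
      (lams-β-select (suc N) applyTo (snoc B w) (inject₁ b) (N ∸ toℕ b) (cong (N ∸_) (sym (toℕ-inject₁ b))))
    where
    applyTo : Plug
    applyTo = record
      { plug        = λ u → app (val u) (encStr r)
      ; substT-plug = λ j s u _ → cong (app (val (substV j s u))) (subst-closed j s (encStr-closed r))
      }

-- cons b = λr.λκ. κ ⌜b r⌝, in continuation-passing style since ⌜b r⌝ is not a value of r.
cons : ∀ {N} → Fin N → Val
cons {N} b = lam (val (lam (app (val (var 0)) (lam (lams N (app (val (var (N ∸ toℕ b))) (var (N + 2))))))))

cons-closed : ∀ {N} (b : Fin N) → Closed (cons b)
cons-closed {N} b =
  s≤s z≤n , closedT-lams N _ (∸<+suc N (toℕ b) 2 , ≤-reflexive (sym (+-suc N 2)))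

consᶜ : ∀ {N} → Fin N → ClosedVal
consᶜ b = cons b , cons-closed b

cons-β : ∀ {N} (b : Fin N) (r : List (Fin N)) κ → Closed κ →
  Reds 2 (app (app (val (cons b)) (encStr r)) κ) (app (val κ) (encStr (b ∷ r)))
cons-β {N} b r κ cκ = step⟶ (ctx (β≡ bind-r)) (step⟶ (β≡ bind-κ) refl⟶)
  where
  ⌜r⌝ = encStr r
  cr  = encStr-closed r
  i   = N ∸ toℕ b
  bind-r : val (lam (app (val (var 0)) (lam (lams N (app (val (var i)) ⌜r⌝)))))
         ≡ val (lam (app (val (var 0)) (lam (lams N (app (val (var i)) (var (N + 2))))))) [ ⌜r⌝ ≔]
  bind-r rewrite shift-closed {⌜r⌝} 0 cr | shift-closed {⌜r⌝} 0 cr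
               | substT-lams N 2 ⌜r⌝ cr (app (val (var i)) (var (N + 2)))
               | substV-var-< {i} {N + 2} {⌜r⌝} (∸<+suc N (toℕ b) 1)
               | substV-var-≡ {N + 2} {⌜r⌝} = refl
  bind-κ : app (val κ) (encStr (b ∷ r)) ≡ app (val (var 0)) (lam (lams N (app (val (var i)) ⌜r⌝))) [ κ ≔]
  bind-κ = cong (app (val κ)) (sym (subst-closed 0 κ (encStr-closed (b ∷ r))))

Never-halts : (M : TM) → Config M → Set
Never-halts M C = ∀ n D → Steps M n C D → ¬ Final M D

progress⇒diverges : (P : Term → Set) → (∀ {t} → P t → Σ Term λ u → (t ⟶ u) × P u) →
  ∀ {t} → P t → Diverges t
progress⇒diverges P progress {t} Pt = proj₁ ∘ iterate , refl , λ i → proj₁ (proj₂ (progress (proj₂ (iterate i))))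
  where
  iterate : ℕ → Σ Term P
  iterate zero    = t , Pt
  iterate (suc i) with progress (proj₂ (iterate i))
  ... | u , _ , Pu = u , Pu

module Simulation (M : TM) (run out : Config M → Term) (b : ℕ)
  (advance : ∀ C (ne : state C ≢ TM.qfin M) → run C ⇒⁺⟨ b ⟩ run (next M C ne))
  (halt : ∀ C → Final M C → run C ⇒⟨ b ⟩ out C) where

  simulate-halting : ∀ C D n → Steps M n C D → Final M D → run C ⇒⟨ b * n + b ⟩ out D
  simulate-halting C .C zero done fin = relax (≤-reflexive (cong (_+ b) (sym (*-zeroʳ b)))) (halt C fin)
  simulate-halting C D (suc n) (step ne steps) fin =
    relax (≤-reflexive b+[b*n+b]≡b*suc[n]+b) (one ⨾ simulate-halting _ D n steps fin)
    where
    one : run C ⇒⟨ b ⟩ run (next M C ne)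
    one with advance C ne
    ... | j , j<b , rs = suc j , j<b , rs
    b+[b*n+b]≡b*suc[n]+b : b + (b * n + b) ≡ b * suc n + b
    b+[b*n+b]≡b*suc[n]+b = begin
      b + (b * n + b) ≡⟨ sym (+-assoc b (b * n) b) ⟩
      b + b * n + b   ≡⟨ cong (_+ b) (sym (*-suc b n)) ⟩
      b * suc n + b   ∎
      where open ≡-Reasoning

  simulate-diverging : ∀ C → Never-halts M C → Diverges (run C)
  simulate-diverging C never = progress⇒diverges Reaches-running progress (C , never , 0 , refl⟶)
    where
    Reaches-running : Term → Set
    Reaches-running t = ∃ λ C → Never-halts M C × ∃ λ j → Reds j t (run C)
    progress : ∀ {t} → Reaches-running t → Σ Term λ u → (t ⟶ u) × Reaches-running u
    progress (C , never , suc j , step⟶ r rs) = _ , r , C , never , j , rs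
    progress (C , never , zero , refl⟶) with advance C (never 0 C done)
    ... | j , _ , step⟶ r rs = _ , r , next M C (never 0 C done) , never′ , j , rs
      where
      never′ : Never-halts M (next M C (never 0 C done))
      never′ n D steps = never (suc n) D (step (never 0 C done) steps)

module Machine (M : TM) where
  open TM M

  private
    N : ℕ
    N = suc n

  ‹letter› : ∀ {k} → Fin k → TmplV
  ‹letter› i = ‹ letterᶜ i ›

  ‹string› : ∀ {k} → List (Fin k) → TmplV
  ‹string› r = ‹ stringᶜ r ›

  -- Configurations as the encoding sees them: the left tape is stored reversed.
  record RConfig : Set where
    constructor ⟪_,_,_,_⟫
    field
      leftʳ : List (Sym M)
      headʳ : Sym M
      rightʳ : List (Sym M)
      stateʳ : Fin m

  configᵀ : RConfig → TmplV
  configᵀ ⟪ sʳ , a , r , q ⟫ = ƛ (⌊ # 0 ⌋ · ‹string› sʳ · ‹letter› a · ‹string› r · ‹letter› q)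

  ⌜_⌝ʳ : RConfig → Val
  ⌜ D ⌝ʳ = ⟦ configᵀ D ⟧ᵛ

  ⌜⌝ʳ-closed : ∀ D → Closed ⌜ D ⌝ʳ
  ⌜⌝ʳ-closed D = closedᵇᵛ-sound 0 (configᵀ D) tt

  moveLeftʳ : Sym M → List (Sym M) → Fin m → List (Sym M) → RConfig
  moveLeftʳ ah r ql []        = ⟪ [] , □ M , ah ∷ r , ql ⟫
  moveLeftʳ ah r ql (ap ∷ sʳ) = ⟪ sʳ , ap , ah ∷ r , ql ⟫

  moveRightʳ : List (Sym M) → Fin m → List (Sym M) → RConfig
  moveRightʳ sʳ ql []       = ⟪ sʳ , □ M , [] , ql ⟫
  moveRightʳ sʳ ql (ap ∷ r) = ⟪ sʳ , ap , r , ql ⟫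

  performʳ : List (Sym M) → List (Sym M) → Fin m × Sym M × Dir → RConfig
  performʳ sʳ r (ql , ah , S) = ⟪ sʳ , ah , r , ql ⟫
  performʳ sʳ r (ql , ah , L) = moveLeftʳ ah r ql sʳ
  performʳ sʳ r (ql , ah , R) = moveRightʳ (ah ∷ sʳ) ql r

  encConfig-next : ∀ s a r q ne →
    encConfig M (next M ⟨ s , a , r , q ⟩ ne) ≡ ⌜ performʳ (reverse s) r (δ q ne a) ⌝ʳ
  encConfig-next s a r q ne with δ q ne a
  ... | ql , ah , S = refl
  ... | ql , ah , L with reverse s
  ...   | []      = refl
  ...   | ap ∷ sʳ = cong (λ t → ⌜ ⟪ t , ap , ah ∷ r , ql ⟫ ⌝ʳ) (reverse-involutive sʳ)
  encConfig-next s a r q ne | ql , ah , R with r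
  ...   | []      = cong (λ t → ⌜ ⟪ t , □ M , [] , ql ⟫ ⌝ʳ) (reverse-++ s [ ah ])
  ...   | ap ∷ r′ = cong (λ t → ⌜ ⟪ t , ap , r′ , ql ⟫ ⌝ʳ) (reverse-++ s [ ah ])

  -- Named forms, with ⟨s, a, r, q⟩ = λx. x s a r q, s the reversed left tape, y the
  -- handle loop and k the continuation (y y k ⌜D⌝ is trans k ⌜D⌝):
  --   loop              = λy k c. c unpack y k
  --   unpack            = λs a r q y. onState q y s a r
  --   stateBranch q     = λy s a r. onSymbol q a y s r      (q ≠ q_fin)
  --   stateBranch q_fin = λy s a r k. k ⟨s, a, r, q_fin⟩
  --   act (ql, ah, S)   = λy s r k. y y k ⟨s, ah, r, ql⟩
  --   act (ql, ah, L)   = λy s r. cons ah r (λr′. moveLeft ql s y r′)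
  --   act (ql, ah, R)   = λy s r. cons ah s (λs′. moveRight ql r y s′)
  --   leftCons ql b     = λp y r k. y y k ⟨p, b, r, ql⟩     leftNil ql  = λy r k. y y k ⟨ε, □, r, ql⟩
  --   rightCons ql b    = λp y s k. y y k ⟨s, b, p, ql⟩     rightNil ql = λy s k. y y k ⟨s, □, ε, ql⟩
  leftConsᵀ rightConsᵀ : Fin m → Sym M → Tmpl
  leftConsᵀ ql b  = ⌊ ƛ (⌊ # 2 ⌋ · # 2 · # 0 · ƛ (⌊ # 0 ⌋ · # 4 · ‹letter› b · # 2 · ‹letter› ql)) ⌋
  rightConsᵀ ql b = ⌊ ƛ (⌊ # 2 ⌋ · # 2 · # 0 · ƛ (⌊ # 0 ⌋ · # 2 · ‹letter› b · # 4 · ‹letter› ql)) ⌋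

  leftNilᵀ rightNilᵀ : Fin m → Tmpl
  leftNilᵀ ql  = ⌊ ƛ (⌊ # 2 ⌋ · # 2 · # 0 · ƛ (⌊ # 0 ⌋ · ‹string› {N} [] · ‹letter› (□ M) · # 2 · ‹letter› ql)) ⌋
  rightNilᵀ ql = ⌊ ƛ (⌊ # 2 ⌋ · # 2 · # 0 · ƛ (⌊ # 0 ⌋ · # 2 · ‹letter› (□ M) · ‹string› {N} [] · ‹letter› ql)) ⌋

  leftCons rightCons : Fin m → Sym M → ClosedVal
  leftCons ql b  = combinator 2 (leftConsᵀ ql b) tt
  rightCons ql b = combinator 2 (rightConsᵀ ql b) tt

  leftNil rightNil : Fin m → ClosedVal
  leftNil ql  = combinator 1 (leftNilᵀ ql) tt
  rightNil ql = combinator 1 (rightNilᵀ ql) tt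

  leftBranches rightBranches : Fin m → Fin (suc N) → ClosedVal
  leftBranches ql  = snoc (leftCons ql) (leftNil ql)
  rightBranches ql = snoc (rightCons ql) (rightNil ql)

  moveLeft moveRight : Fin m → ClosedVal
  moveLeft ql  = dispatch (tabulate (leftBranches ql))
  moveRight ql = dispatch (tabulate (rightBranches ql))

  actᵀ : Fin m × Sym M × Dir → Tmpl
  actᵀ (ql , ah , S) = ⌊ ƛ (⌊ # 3 ⌋ · # 3 · # 0 · ƛ (⌊ # 0 ⌋ · # 3 · ‹letter› ah · # 2 · ‹letter› ql)) ⌋
  actᵀ (ql , ah , L) = ⌊ ‹ consᶜ ah › ⌋ · # 0 · ƛ (⌊ ‹ moveLeft ql › ⌋ · # 2 · # 3 · # 0)
  actᵀ (ql , ah , R) = ⌊ ‹ consᶜ ah › ⌋ · # 1 · ƛ (⌊ ‹ moveRight ql › ⌋ · # 1 · # 3 · # 0)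

  -- Split on the direction so that the closedness check of actᵀ computes.
  act : Fin m × Sym M × Dir → ClosedVal
  act tr@(_ , _ , S) = combinator 2 (actᵀ tr) tt
  act tr@(_ , _ , L) = combinator 2 (actᵀ tr) tt
  act tr@(_ , _ , R) = combinator 2 (actᵀ tr) tt

  onSymbol : (q : Fin m) → q ≢ qfin → ClosedVal
  onSymbol q ne = dispatch (tabulate (λ a → act (δ q ne a)))

  haltᵀ : Tmpl
  haltᵀ = ⌊ ƛ (⌊ # 0 ⌋ · ƛ (⌊ # 0 ⌋ · # 4 · # 3 · # 2 · ‹letter› qfin)) ⌋

  onSymbolᵀ : (q : Fin m) → q ≢ qfin → Tmpl
  onSymbolᵀ q ne = ⌊ ‹ onSymbol q ne › ⌋ · # 1 · # 3 · # 2 · # 0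

  stateBranch : (q : Fin m) → Dec (q ≡ qfin) → ClosedVal
  stateBranch q (yes _) = combinator 3 haltᵀ tt
  stateBranch q (no ne) = combinator 3 (onSymbolᵀ q ne) tt

  stateBranches : Fin m → ClosedVal
  stateBranches q = stateBranch q (q ≟ qfin)

  onState : ClosedVal
  onState = dispatch (tabulate stateBranches)

  unpackᵀ : Tmpl
  unpackᵀ = ⌊ ‹ onState › ⌋ · # 1 · # 0 · # 4 · # 3 · # 2

  unpack : ClosedVal
  unpack = combinator 4 unpackᵀ tt

  loopᵀ : Tmpl
  loopᵀ = ⌊ # 0 ⌋ · ‹ unpack › · # 2 · # 1

  loop : ClosedVal
  loop = combinator 2 loopᵀ tt

  trans : Term
  trans = app (val (proj₁ loop)) (proj₁ loop)

  private
    Y : Val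
    Y = proj₁ loop

  continue-β : ∀ K D → Closed D → Reds 1 (app (val (lam (app (app trans (var 0)) D))) K) (app (app trans K) D)
  continue-β K D cD = step⟶ (β≡ bind) refl⟶
    where
    bind : app (app trans K) D ≡ app (app trans (var 0)) D [ K ≔]
    bind rewrite subst-closed {Y} 0 K (proj₂ loop) | subst-closed {D} 0 K cD = refl

  return-β : ∀ K D → Closed D → Reds 1 (app (val (lam (app (val (var 0)) D))) K) (app (val K) D)
  return-β K D cD = step⟶ (β≡ (cong (app (val K)) (sym (subst-closed 0 K cD)))) refl⟶

  -- The continuation k need not be closed, so it is never substituted into.
  loop-β : ∀ K c → Closed c → Reds 3 (app (app trans K) c) (apps (val c) (proj₁ unpack ∷ Y ∷ K ∷ []))
  loop-β K c cc =
    step⟶ (ctx (ctx (β≡ (sym (substT-⟦⟧ 0 loop (tlams 2 loopᵀ))))))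
      (step⟶ (ctx (β≡ bind-k)) (step⟶ (β≡ bind-c) refl⟶))
    where
    U = proj₁ unpack
    bind-k : val (lam (app (app (app (val (var 0)) U) Y) (shiftV 0 K)))
           ≡ val (lam (app (app (app (val (var 0)) U) Y) (var 1))) [ K ≔]
    bind-k rewrite subst-closed {U} 1 (shiftV 0 K) (proj₂ unpack)
                 | subst-closed {Y} 1 (shiftV 0 K) (proj₂ loop) = refl
    bind-c : app (app (app (val c) U) Y) K ≡ app (app (app (val (var 0)) U) Y) (shiftV 0 K) [ c ≔]
    bind-c rewrite subst-closed {U} 0 c (proj₂ unpack) | subst-closed {Y} 0 c (proj₂ loop)
                 | substV-shiftV 0 c K = refl

  trans-β : ∀ K sʳ a r q →
    Reds (3 + (1 + (5 + (1 + m)))) (app (app trans K) ⌜ ⟪ sʳ , a , r , q ⟫ ⌝ʳ)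
      (apps (val (proj₁ (stateBranches q))) (Y ∷ encStr sʳ ∷ encLetter a ∷ encStr r ∷ K ∷ []))
  trans-β K sʳ a r q =
       loop-β K _ (⌜⌝ʳ-closed ⟪ sʳ , a , r , q ⟫)
    ◅◅ Reds-apps (Y ∷ K ∷ []) (tlams-β* (⌊ # 0 ⌋ · ‹string› sʳ · ‹letter› a · ‹string› r · ‹letter› q) (unpack ∷ []))
    ◅◅ Reds-apps (K ∷ []) (tlams-β* unpackᵀ (stringᶜ sʳ ∷ letterᶜ a ∷ stringᶜ r ∷ letterᶜ q ∷ loop ∷ []))
    ◅◅ Reds-apps (Y ∷ encStr sʳ ∷ encLetter a ∷ encStr r ∷ K ∷ []) (dispatch-β (tabulate stateBranches) (encLetter q))
    ◅◅ Reds-apps (Y ∷ encStr sʳ ∷ encLetter a ∷ encStr r ∷ K ∷ []) (encLetter-select q stateBranches)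

  halt-β : ∀ K sʳ a r (d : Dec (qfin ≡ qfin)) →
    Reds 5 (apps (val (proj₁ (stateBranch qfin d))) (Y ∷ encStr sʳ ∷ encLetter a ∷ encStr r ∷ K ∷ []))
      (app (val K) ⌜ ⟪ sʳ , a , r , qfin ⟫ ⌝ʳ)
  halt-β K sʳ a r (yes _) =
       Reds-apps (K ∷ []) (tlams-β* haltᵀ (loop ∷ stringᶜ sʳ ∷ letterᶜ a ∷ stringᶜ r ∷ []))
    ◅◅ return-β K _ (⌜⌝ʳ-closed ⟪ sʳ , a , r , qfin ⟫)
  halt-β K sʳ a r (no qfin≢qfin) = contradiction refl qfin≢qfin

  moveCost : ℕ
  moveCost = 1 + (suc N + 4)

  moveLeft-β : ∀ K ah r ql sʳ →
    apps (val (proj₁ (moveLeft ql))) (encStr sʳ ∷ Y ∷ encStr (ah ∷ r) ∷ K ∷ [])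
      ⇒⟨ moveCost ⟩ app (app trans K) ⌜ moveLeftʳ ah r ql sʳ ⌝ʳ
  moveLeft-β K ah r ql sʳ =
    exactly (Reds-apps (Y ∷ encStr (ah ∷ r) ∷ K ∷ []) (dispatch-β (tabulate (leftBranches ql)) (encStr sʳ)))
    ⨾ select sʳ
    where
    select : ∀ sʳ → apps (apps (val (encStr sʳ)) (map proj₁ (tabulate (leftBranches ql)))) (Y ∷ encStr (ah ∷ r) ∷ K ∷ [])
                      ⇒⟨ suc N + 4 ⟩ app (app trans K) ⌜ moveLeftʳ ah r ql sʳ ⌝ʳ
    select [] = relax (+-monoʳ-≤ (suc N) (n≤1+n 3)) (exactly (
         Reds-apps (Y ∷ encStr (ah ∷ r) ∷ K ∷ []) (encStr-[]-select N (leftCons ql) (leftNil ql))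
      ◅◅ Reds-apps (K ∷ []) (tlams-β* (leftNilᵀ ql) (loop ∷ stringᶜ (ah ∷ r) ∷ []))
      ◅◅ continue-β K _ (⌜⌝ʳ-closed ⟪ [] , □ M , ah ∷ r , ql ⟫)))
    select (ap ∷ sʳ) = exactly (
         Reds-apps (Y ∷ encStr (ah ∷ r) ∷ K ∷ []) (encStr-∷-select N (leftCons ql) (leftNil ql) ap sʳ)
      ◅◅ Reds-apps (K ∷ []) (tlams-β* (leftConsᵀ ql ap) (stringᶜ sʳ ∷ loop ∷ stringᶜ (ah ∷ r) ∷ []))
      ◅◅ continue-β K _ (⌜⌝ʳ-closed ⟪ sʳ , ap , ah ∷ r , ql ⟫))

  moveRight-β : ∀ K sʳ ql r →
    apps (val (proj₁ (moveRight ql))) (encStr r ∷ Y ∷ encStr sʳ ∷ K ∷ [])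
      ⇒⟨ moveCost ⟩ app (app trans K) ⌜ moveRightʳ sʳ ql r ⌝ʳ
  moveRight-β K sʳ ql r =
    exactly (Reds-apps (Y ∷ encStr sʳ ∷ K ∷ []) (dispatch-β (tabulate (rightBranches ql)) (encStr r)))
    ⨾ select r
    where
    select : ∀ r → apps (apps (val (encStr r)) (map proj₁ (tabulate (rightBranches ql)))) (Y ∷ encStr sʳ ∷ K ∷ [])
                     ⇒⟨ suc N + 4 ⟩ app (app trans K) ⌜ moveRightʳ sʳ ql r ⌝ʳ
    select [] = relax (+-monoʳ-≤ (suc N) (n≤1+n 3)) (exactly (
         Reds-apps (Y ∷ encStr sʳ ∷ K ∷ []) (encStr-[]-select N (rightCons ql) (rightNil ql))
      ◅◅ Reds-apps (K ∷ []) (tlams-β* (rightNilᵀ ql) (loop ∷ stringᶜ sʳ ∷ []))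
      ◅◅ continue-β K _ (⌜⌝ʳ-closed ⟪ sʳ , □ M , [] , ql ⟫)))
    select (ap ∷ r) = exactly (
         Reds-apps (Y ∷ encStr sʳ ∷ K ∷ []) (encStr-∷-select N (rightCons ql) (rightNil ql) ap r)
      ◅◅ Reds-apps (K ∷ []) (tlams-β* (rightConsᵀ ql ap) (stringᶜ r ∷ loop ∷ stringᶜ sʳ ∷ []))
      ◅◅ continue-β K _ (⌜⌝ʳ-closed ⟪ sʳ , ap , r , ql ⟫))

  actCost : ℕ
  actCost = 6 + moveCost

  act-β : ∀ K sʳ r tr →
    apps (val (proj₁ (act tr))) (Y ∷ encStr sʳ ∷ encStr r ∷ K ∷ [])
      ⇒⟨ actCost ⟩ app (app trans K) ⌜ performʳ sʳ r tr ⌝ʳ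
  act-β K sʳ r tr@(ql , ah , S) = relax (m≤m+n 4 (2 + moveCost)) (exactly (
       Reds-apps (K ∷ []) (tlams-β* (actᵀ tr) (loop ∷ stringᶜ sʳ ∷ stringᶜ r ∷ []))
    ◅◅ continue-β K _ (⌜⌝ʳ-closed ⟪ sʳ , ah , r , ql ⟫)))
  act-β K sʳ r tr@(ql , ah , L) =
    exactly (
         Reds-apps (K ∷ []) (tlams-β* (actᵀ tr) (loop ∷ stringᶜ sʳ ∷ stringᶜ r ∷ []))
      ◅◅ Reds-apps (K ∷ []) (cons-β ah r ⟦ ƛ κᵀ ⟧ᵛ (closedᵇᵛ-sound 0 (ƛ κᵀ) tt))
      ◅◅ Reds-apps (K ∷ []) (tlams-β* κᵀ (stringᶜ (ah ∷ r) ∷ [])))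
    ⨾ moveLeft-β K ah r ql sʳ
    where
    κᵀ = ⌊ ‹ moveLeft ql › ⌋ · ‹ stringᶜ sʳ › · ‹ loop › · # 0
  act-β K sʳ r tr@(ql , ah , R) =
    exactly (
         Reds-apps (K ∷ []) (tlams-β* (actᵀ tr) (loop ∷ stringᶜ sʳ ∷ stringᶜ r ∷ []))
      ◅◅ Reds-apps (K ∷ []) (cons-β ah sʳ ⟦ ƛ κᵀ ⟧ᵛ (closedᵇᵛ-sound 0 (ƛ κᵀ) tt))
      ◅◅ Reds-apps (K ∷ []) (tlams-β* κᵀ (stringᶜ (ah ∷ sʳ) ∷ [])))
    ⨾ moveRight-β K (ah ∷ sʳ) ql r
    where
    κᵀ = ⌊ ‹ moveRight ql › ⌋ · ‹ stringᶜ r › · ‹ loop › · # 0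

  transitionCost : ℕ
  transitionCost = 4 + (1 + (N + actCost))

  transition-β : ∀ K sʳ a r q (ne : q ≢ qfin) (d : Dec (q ≡ qfin)) →
    apps (val (proj₁ (stateBranch q d))) (Y ∷ encStr sʳ ∷ encLetter a ∷ encStr r ∷ K ∷ [])
      ⇒⟨ transitionCost ⟩ app (app trans K) ⌜ performʳ sʳ r (δ q ne a) ⌝ʳ
  transition-β K sʳ a r q ne (yes q≡qfin) = contradiction q≡qfin ne
  transition-β K sʳ a r q ne (no _) =
    exactly (
         Reds-apps (K ∷ []) (tlams-β* (onSymbolᵀ q ne) (loop ∷ stringᶜ sʳ ∷ letterᶜ a ∷ stringᶜ r ∷ []))
      ◅◅ Reds-apps (Y ∷ encStr sʳ ∷ encStr r ∷ K ∷ []) (dispatch-β (tabulate (act ∘ δ q ne)) (encLetter a))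
      ◅◅ Reds-apps (Y ∷ encStr sʳ ∷ encStr r ∷ K ∷ []) (encLetter-select a (act ∘ δ q ne)))
    ⨾ act-β K sʳ r (δ q ne a)

  unfoldCost cost : ℕ
  unfoldCost = 3 + (1 + (5 + (1 + m)))
  cost       = unfoldCost + transitionCost

  trans-advance : ∀ K (C : Config M) (ne : state C ≢ qfin) →
    app (app trans K) (encConfig M C) ⇒⁺⟨ cost ⟩ app (app trans K) (encConfig M (next M C ne))
  trans-advance K ⟨ s , a , r , q ⟩ ne
    with transition-β K (reverse s) a r q ne (q ≟ qfin)
  ... | j , j≤ , rs rewrite encConfig-next s a r q ne =
    _ , +-monoʳ-≤ unfoldCost j≤ , trans-β K (reverse s) a r q ◅◅ rs

  trans-halt : ∀ K (C : Config M) → Final M C → app (app trans K) (encConfig M C) ⇒⟨ cost ⟩ app (val K) (encConfig M C)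
  trans-halt K ⟨ s , a , r , q ⟩ refl =
    relax (+-monoʳ-≤ unfoldCost (m≤m+n 5 (N + actCost)))
      (exactly (trans-β K (reverse s) a r qfin ◅◅ halt-β K (reverse s) a r (qfin ≟ qfin)))

corollary1 : (M : TM) →
    Σ Term λ trans → Σ ℕ λ c →
      (∀ (k : Val) (C D : Config M) (n : ℕ) → Steps M n C D → Final M D →
        Σ ℕ λ j → (j ≤ c * n + c) ×
          Reds j (app (app trans k) (encConfig M C)) (app (val k) (encConfig M D)))
      ×
      (∀ (k : Val) (C : Config M) →
        (∀ (n : ℕ) (D : Config M) → Steps M n C D → ¬ Final M D) →
        Diverges (app (app trans k) (encConfig M C)))
corollary1 M =
    trans , cost
  , (λ k → Simulation.simulate-halting M (run k) (out k) cost (trans-advance k) (trans-halt k))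
  , (λ k → Simulation.simulate-diverging M (run k) (out k) cost (trans-advance k) (trans-halt k))
  where
  open Machine M
  run out : Val → Config M → Term
  run k C = app (app trans k) (encConfig M C)
  out k C = app (val k) (encConfig M C)
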